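{- Let $k\ge 4$ be an integer and let $G$ be a graph containing a $3$-cycle $uvw$ with $\deg_G(u)=\deg_G(v)=k-1$. Then the induced subgraph $H=G[\{u,v,w\}]$ is a $(\{K_4^-\},k)$-boundary-reducible induced subgraph of $G$ with boundary $\{w\}$.
   Context: $K_4^-$ is $K_4$ minus one edge. For $f:V(H)\to\mathbb{Z}$ and $x\in V(H)$, $f\downarrow x$ equals $f$ except $(f\downarrow x)(x)=1$; a list assignment $L$ is an $f$-assignment if $|L(y)|\ge f(y)$ for all $y$; $1_I$ is the indicator of $I$; an $L$-coloring is a proper coloring with $\varphi(y)\in L(y)$. For a set $\mathcal{F}$ of graphs, $I\subseteq V(H)$ is $\mathcal{F}$-forbidding if $H$ plus one new vertex adjacent exactly to $I$ contains no graph of $\mathcal{F}$ as a subgraph. An induced subgraph $H$ of $G$ is $(\mathcal{F},k)$-boundary-reducible with boundary $B\subsetneq V(H)$ if, with $g(y)=k-\deg_G(y)+\deg_{H-B}(y)$ for $y\in V(H-B)$: (FIX) for every $x\in V(H)\setminus B$, $H-B$ is $L$-colorable for every $(g\downarrow x)$-assignment $L$; and (FORB) for every $\mathcal{F}$-forbidding $I\subseteq V(H)\setminus B$ with $|I|\le k-2$, $H-B$ is $L$-colorable for every $(g-1_I)$-assignment $L$. -}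

module Defs where

open import Data.Bool using (Bool; true; false; if_then_else_)
open import Data.Nat using (ℕ; zero; suc; _≤_; _+_)
open import Data.Integer as ℤ using (ℤ; +_)
open import Data.Fin using (Fin; _≟_)
open import Data.Fin.Subset using (Subset; _∈_; _∩_; ∣_∣)
open import Data.Vec using (Vec; tabulate; lookup)
open import Data.Maybe using (Maybe; just; nothing)
open import Data.List using (List; length)
open import Data.List.Relation.Unary.Unique.Propositional using (Unique)
import Data.List.Membership.Propositional as LM
open import Data.Product using (Σ; _×_)
open import Data.Unit using (⊤)
open import Relation.Binary.PropositionalEquality using (_≡_; _≢_)
open import Relation.Nullary using (¬_; does)
open import Function.Definitions using (Injective)

record Graph : Set where
  field
    n      : ℕ
    adj    : Fin n → Fin n → Bool
    sym    : ∀ x y → adj x y ≡ adj y x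
    irrefl : ∀ x → adj x x ≡ false
open Graph public

N : (G : Graph) → Fin (n G) → Subset (n G)
N G y = tabulate (adj G y)

deg : (G : Graph) → Fin (n G) → ℕ
deg G y = ∣ N G y ∣

degIn : (G : Graph) → Subset (n G) → Fin (n G) → ℕ
degIn G S y = ∣ N G y ∩ S ∣

-- K4 minus the edge {0,1}
K4⁻adj : Fin 4 → Fin 4 → Bool
K4⁻adj Fin.zero Fin.zero = false
K4⁻adj Fin.zero (Fin.suc Fin.zero) = false
K4⁻adj (Fin.suc Fin.zero) Fin.zero = false
K4⁻adj (Fin.suc Fin.zero) (Fin.suc Fin.zero) = false
K4⁻adj (Fin.suc (Fin.suc Fin.zero)) (Fin.suc (Fin.suc Fin.zero)) = false
K4⁻adj (Fin.suc (Fin.suc (Fin.suc Fin.zero))) (Fin.suc (Fin.suc (Fin.suc Fin.zero))) = false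
K4⁻adj _ _ = true

K4⁻ : Graph
K4⁻ = record { n = 4 ; adj = K4⁻adj ; sym = s ; irrefl = i }
  where
  s : ∀ x y → K4⁻adj x y ≡ K4⁻adj y x
  s Fin.zero Fin.zero = _≡_.refl
  s Fin.zero (Fin.suc Fin.zero) = _≡_.refl
  s Fin.zero (Fin.suc (Fin.suc Fin.zero)) = _≡_.refl
  s Fin.zero (Fin.suc (Fin.suc (Fin.suc Fin.zero))) = _≡_.refl
  s (Fin.suc Fin.zero) Fin.zero = _≡_.refl
  s (Fin.suc Fin.zero) (Fin.suc Fin.zero) = _≡_.refl
  s (Fin.suc Fin.zero) (Fin.suc (Fin.suc Fin.zero)) = _≡_.refl
  s (Fin.suc Fin.zero) (Fin.suc (Fin.suc (Fin.suc Fin.zero))) = _≡_.refl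
  s (Fin.suc (Fin.suc Fin.zero)) Fin.zero = _≡_.refl
  s (Fin.suc (Fin.suc Fin.zero)) (Fin.suc Fin.zero) = _≡_.refl
  s (Fin.suc (Fin.suc Fin.zero)) (Fin.suc (Fin.suc Fin.zero)) = _≡_.refl
  s (Fin.suc (Fin.suc Fin.zero)) (Fin.suc (Fin.suc (Fin.suc Fin.zero))) = _≡_.refl
  s (Fin.suc (Fin.suc (Fin.suc Fin.zero))) Fin.zero = _≡_.refl
  s (Fin.suc (Fin.suc (Fin.suc Fin.zero))) (Fin.suc Fin.zero) = _≡_.refl
  s (Fin.suc (Fin.suc (Fin.suc Fin.zero))) (Fin.suc (Fin.suc Fin.zero)) = _≡_.refl
  s (Fin.suc (Fin.suc (Fin.suc Fin.zero))) (Fin.suc (Fin.suc (Fin.suc Fin.zero))) = _≡_.refl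
  i : ∀ x → K4⁻adj x x ≡ false
  i Fin.zero = _≡_.refl
  i (Fin.suc Fin.zero) = _≡_.refl
  i (Fin.suc (Fin.suc Fin.zero)) = _≡_.refl
  i (Fin.suc (Fin.suc (Fin.suc Fin.zero))) = _≡_.refl

-- Vertices of G[S] plus one new vertex z (= nothing)
InExt : {m : ℕ} → Subset m → Maybe (Fin m) → Set
InExt S nothing  = ⊤
InExt S (just a) = a ∈ S

-- adjacency in G[S] + z, where z is adjacent exactly to I
extAdj : (G : Graph) → Subset (n G) → Maybe (Fin (n G)) → Maybe (Fin (n G)) → Bool
extAdj G I nothing  nothing  = false
extAdj G I nothing  (just b) = lookup I b
extAdj G I (just a) nothing  = lookup I a
extAdj G I (just a) (just b) = adj G a b

ContainsExt : (F G : Graph) → Subset (n G) → Subset (n G) → Set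
ContainsExt F G S I =
  Σ (Fin (n F) → Maybe (Fin (n G))) λ ι →
    Injective _≡_ _≡_ ι
    × (∀ a → InExt S (ι a))
    × (∀ a b → adj F a b ≡ true → extAdj G I (ι a) (ι b) ≡ true)

Forbidding : (Graph → Set) → (G : Graph) → Subset (n G) → Subset (n G) → Set
Forbidding 𝓕 G S I = ∀ F → 𝓕 F → ¬ ContainsExt F G S I

-- L is an f-assignment on the vertex set R (lists are duplicate-free, so length = size)
IsAssignment : {m : ℕ} → Subset m → (Fin m → ℤ) → (Fin m → List ℕ) → Set
IsAssignment R f L = ∀ y → y ∈ R → Unique (L y) × f y ℤ.≤ + length (L y)

Colorable : (G : Graph) → Subset (n G) → (Fin (n G) → List ℕ) → Set
Colorable G R L =
  Σ (Fin (n G) → ℕ) λ φ →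
    (∀ y → y ∈ R → LM._∈_ (φ y) (L y))
    × (∀ y z → y ∈ R → z ∈ R → adj G y z ≡ true → φ y ≢ φ z)

_↓_ : {m : ℕ} → (Fin m → ℤ) → Fin m → (Fin m → ℤ)
(f ↓ x) y = if does (y ≟ x) then + 1 else f y

𝟙 : {m : ℕ} → Subset m → Fin m → ℤ
𝟙 I y = if lookup I y then + 1 else + 0

BoundaryReducible : (𝓕 : Graph → Set) → ℕ → (G : Graph) → (S B : Subset (n G)) → Set
BoundaryReducible 𝓕 k G S B =
  Data.Fin.Subset._⊂_ B S
  × (∀ x → x ∈ R → ∀ L → IsAssignment R (g ↓ x) L → Colorable G R L)
  × (∀ I → Data.Fin.Subset._⊆_ I R → ∣ I ∣ + 2 ≤ k → Forbidding 𝓕 G S I →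
       ∀ L → IsAssignment R (λ y → g y ℤ.- 𝟙 I y) L → Colorable G R L)
  where
  R : Subset (n G)
  R = Data.Fin.Subset._─_ S B
  g : Fin (n G) → ℤ
  g y = (+ k ℤ.- + deg G y) ℤ.+ + degIn G R y

-- Let R = {u, v}. Since deg u = deg v = k - 1 and u, v are adjacent, g(u) = g(v) = 2.
-- Both (FIX) and (FORB) therefore leave a list of size at least 1 on one of u, v and
-- of size at least 2 on the other (for FORB: I cannot contain both u and v, for then
-- w, u, v and the new vertex span a K₄⁻), and such lists always admit a colouring:
-- colour the vertex with the short list first, then avoid that colour at the other.
module Submission where

open import Defs renaming (sym to adj-sym)
open import Data.Nat using (ℕ; _≤_; _+_; suc; s≤s)
import Data.Nat.Properties as ℕₚ
open import Data.Bool using (true; false; if_then_else_)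
open import Data.Fin using (Fin; _≟_)
open import Data.Fin.Patterns using (0F; 1F; 2F; 3F)
open import Data.Fin.Subset using (Subset; ⁅_⁆; _∪_; _∩_; _─_; _∈_; _∉_; _⊆_; _⊂_; inside; outside)
open import Data.Fin.Subset.Properties
  using (x∈⁅x⁆; x∈⁅y⁆⇒x≡y; x∈p∪q⁻; x∈p∪q⁺; x∈p∩q⁺; x∈p∧x≢y⇒x∈p-y; p─q⊆p; p⊆q⇒∣p∣≤∣q∣; ∣⁅x⁆∣≡1)
open import Data.Vec using (_∷_; lookup)
import Data.Vec.Base as Vec
open import Data.Vec.Properties using (lookup∘tabulate; lookup⇒[]=)
open import Data.Integer as ℤ using (ℤ; +_; _⊖_; +≤+)
import Data.Integer.Properties as ℤₚ
open import Data.List using (List; length; _∷_; [])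
open import Data.List.Relation.Unary.AllPairs using (_∷_)
open import Data.List.Relation.Unary.All using (_∷_)
open import Data.List.Relation.Unary.Any using (here; there)
open import Data.List.Relation.Unary.Unique.Propositional using (Unique)
open import Data.List.Membership.Propositional using () renaming (_∈_ to _∈ₗ_)
open import Data.Maybe using (Maybe; just; nothing)
open import Data.Maybe.Properties using (just-injective)
open import Data.Product using (∃₂; _×_; _,_; proj₁; proj₂)
open import Data.Sum using (_⊎_; inj₁; inj₂; swap)
open import Data.Empty using (⊥-elim)
open import Data.Unit using (tt)
open import Function using (_∘_)
open import Relation.Nullary using (¬_; yes; no; does; contradiction)
open import Relation.Nullary.Decidable using (dec-true; dec-false)
open import Relation.Binary.PropositionalEquality using (_≡_; _≢_; refl; sym; trans; cong; subst; module ≡-Reasoning)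

adj⇒≢ : (G : Graph) {a b : Fin (n G)} → adj G a b ≡ true → a ≢ b
adj⇒≢ G {a} a~b refl = contradiction (trans (sym a~b) (irrefl G a)) λ ()

x∈p─q⇒x∉q : ∀ {m} (p q : Subset m) {x} → x ∈ p ─ q → x ∉ q
x∈p─q⇒x∉q (_ ∷ p) (outside ∷ q) Vec.here ()
x∈p─q⇒x∉q (_ ∷ p) (outside ∷ q) (Vec.there x∈p─q) (Vec.there x∈q) = x∈p─q⇒x∉q p q x∈p─q x∈q
x∈p─q⇒x∉q (_ ∷ p) (inside ∷ q) (Vec.there x∈p─q) (Vec.there x∈q) = x∈p─q⇒x∉q p q x∈p─q x∈q

distinct-members : (xs ys : List ℕ) → 1 ≤ length xs → 2 ≤ length ys → Unique ys →
  ∃₂ λ α β → α ∈ₗ xs × β ∈ₗ ys × α ≢ β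
distinct-members [] _ () _
distinct-members (_ ∷ _) [] _ () _
distinct-members (_ ∷ _) (_ ∷ []) _ (s≤s ()) _
distinct-members (α ∷ _) (β₁ ∷ β₂ ∷ _) _ _ ((β₁≢β₂ ∷ _) ∷ _) with α ℕₚ.≟ β₁
... | yes refl = α , β₂ , here refl , there (here refl) , β₁≢β₂
... | no α≢β₁  = α , β₁ , here refl , here refl , α≢β₁

pair-colorable : (G : Graph) (R : Subset (n G)) (L : Fin (n G) → List ℕ) {a b : Fin (n G)} →
  a ≢ b → (∀ {y} → y ∈ R → y ≡ a ⊎ y ≡ b) →
  1 ≤ length (L a) → 2 ≤ length (L b) → Unique (L b) → Colorable G R L
pair-colorable G R L {a} {b} a≢b R⊆ab ∣La∣≥1 ∣Lb∣≥2 Lb-unique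
  with distinct-members (L a) (L b) ∣La∣≥1 ∣Lb∣≥2 Lb-unique
... | α , β , α∈La , β∈Lb , α≢β = φ , φ∈L , φ-proper
  where
  φ : Fin (n G) → ℕ
  φ y = if does (y ≟ a) then α else β

  φa≡α : φ a ≡ α
  φa≡α = cong (if_then α else β) (dec-true (a ≟ a) refl)

  φb≡β : φ b ≡ β
  φb≡β = cong (if_then α else β) (dec-false (b ≟ a) (a≢b ∘ sym))

  φ∈L : ∀ y → y ∈ R → φ y ∈ₗ L y
  φ∈L y y∈R with R⊆ab y∈R
  ... | inj₁ refl = subst (_∈ₗ L a) (sym φa≡α) α∈La
  ... | inj₂ refl = subst (_∈ₗ L b) (sym φb≡β) β∈Lb

  φ-proper : ∀ y z → y ∈ R → z ∈ R → adj G y z ≡ true → φ y ≢ φ z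
  φ-proper y z y∈R z∈R y~z with R⊆ab y∈R | R⊆ab z∈R
  ... | inj₁ refl | inj₁ refl = ⊥-elim (adj⇒≢ G y~z refl)
  ... | inj₁ refl | inj₂ refl = λ φa≡φb → α≢β (trans (sym φa≡α) (trans φa≡φb φb≡β))
  ... | inj₂ refl | inj₁ refl = λ φb≡φa → α≢β (trans (sym φa≡α) (trans (sym φb≡φa) φb≡β))
  ... | inj₂ refl | inj₂ refl = ⊥-elim (adj⇒≢ G y~z refl)

budget : ℕ → (G : Graph) → Subset (n G) → Fin (n G) → ℤ
budget k G R y = (+ k ℤ.- + deg G y) ℤ.+ + degIn G R y

budget≡1+degIn : ∀ k (G : Graph) R y → deg G y + 1 ≡ k → budget k G R y ≡ + suc (degIn G R y)
budget≡1+degIn _ G R y refl = begin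
  (+ (d + 1) ℤ.- + d) ℤ.+ + m  ≡⟨ cong (ℤ._+ + m) (ℤₚ.[+m]-[+n]≡m⊖n (d + 1) d) ⟩
  ((d + 1) ⊖ d) ℤ.+ + m        ≡⟨ cong (λ t → ((d + 1) ⊖ t) ℤ.+ + m) (sym (ℕₚ.+-identityʳ d)) ⟩
  ((d + 1) ⊖ (d + 0)) ℤ.+ + m  ≡⟨ cong (ℤ._+ + m) (ℤₚ.+-cancelˡ-⊖ d 1 0) ⟩
  + suc m                      ∎
  where
  open ≡-Reasoning
  d = deg G y
  m = degIn G R y

adj⇒1≤degIn : (G : Graph) (R : Subset (n G)) {a b : Fin (n G)} →
  adj G a b ≡ true → b ∈ R → 1 ≤ degIn G R a
adj⇒1≤degIn G R {a} {b} a~b b∈R = subst (_≤ degIn G R a) (∣⁅x⁆∣≡1 b) (p⊆q⇒∣p∣≤∣q∣ ⁅b⁆⊆NR)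
  where
  b∈NR : b ∈ N G a ∩ R
  b∈NR = x∈p∩q⁺ (lookup⇒[]= b _ (trans (lookup∘tabulate (adj G a) b) a~b) , b∈R)

  ⁅b⁆⊆NR : ⁅ b ⁆ ⊆ N G a ∩ R
  ⁅b⁆⊆NR x∈⁅b⁆ = subst (_∈ N G a ∩ R) (sym (x∈⁅y⁆⇒x≡y b x∈⁅b⁆)) b∈NR

adj⇒2≤budget : ∀ k (G : Graph) R {a b : Fin (n G)} →
  deg G a + 1 ≡ k → adj G a b ≡ true → b ∈ R → + 2 ℤ.≤ budget k G R a
adj⇒2≤budget k G R da a~b b∈R =
  subst (+ 2 ℤ.≤_) (sym (budget≡1+degIn k G R _ da)) (+≤+ (s≤s (adj⇒1≤degIn G R a~b b∈R)))

assignment⇒length≥ : ∀ {m} {R : Subset m} {f L y c} →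
  IsAssignment R f L → y ∈ R → + c ℤ.≤ f y → c ≤ length (L y)
assignment⇒length≥ A y∈R c≤fy = ℤₚ.drop‿+≤+ (ℤₚ.≤-trans c≤fy (proj₂ (A _ y∈R)))

↓-self : ∀ {m} (f : Fin m → ℤ) x → (f ↓ x) x ≡ + 1
↓-self f x = cong (if_then + 1 else f x) (dec-true (x ≟ x) refl)

↓-other : ∀ {m} (f : Fin m → ℤ) x y → y ≢ x → (f ↓ x) y ≡ f y
↓-other f x y y≢x = cong (if_then + 1 else f y) (dec-false (y ≟ x) y≢x)

-𝟙-outside : ∀ {m} (I : Subset m) y {i} → lookup I y ≡ false → i ℤ.- 𝟙 I y ≡ i
-𝟙-outside I y {i} y∉I = trans (cong (λ b → i ℤ.- (if b then + 1 else + 0)) y∉I) (ℤₚ.+-identityʳ i)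

-𝟙-≥ : ∀ {m} (I : Subset m) y {c i} → + suc c ℤ.≤ i → + c ℤ.≤ i ℤ.- 𝟙 I y
-𝟙-≥ I y = minus-bit (lookup I y)
  where
  minus-bit : ∀ b {c i} → + suc c ℤ.≤ i → + c ℤ.≤ i ℤ.- (if b then + 1 else + 0)
  minus-bit true  c<i = ℤₚ.+-monoˡ-≤ (ℤ.- + 1) c<i
  minus-bit false {c} {i} c<i =
    subst (+ c ℤ.≤_) (sym (ℤₚ.+-identityʳ i)) (ℤₚ.≤-trans (+≤+ (ℕₚ.n≤1+n c)) c<i)

-- K₄⁻ lacks the edge 01; its ends are sent to w and to the new vertex (nothing).
triangle+apex⇒K₄⁻ : (G : Graph) {S I : Subset (n G)} {u v w : Fin (n G)} →
  adj G u v ≡ true → adj G v w ≡ true → adj G u w ≡ true →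
  u ∈ S → v ∈ S → w ∈ S → lookup I u ≡ true → lookup I v ≡ true → ContainsExt K4⁻ G S I
triangle+apex⇒K₄⁻ G {S} {I} {u} {v} {w} u~v v~w u~w u∈S v∈S w∈S u∈I v∈I =
  ι , ι-injective , ι∈S , ι-edges
  where
  ι : Fin 4 → Maybe (Fin (n G))
  ι 0F = just w
  ι 1F = nothing
  ι 2F = just u
  ι 3F = just v

  u≢v : u ≢ v
  u≢v = adj⇒≢ G u~v
  v≢w : v ≢ w
  v≢w = adj⇒≢ G v~w
  u≢w : u ≢ w
  u≢w = adj⇒≢ G u~w

  ι-injective : ∀ {a b} → ι a ≡ ι b → a ≡ b
  ι-injective {0F} {0F} _ = refl
  ι-injective {1F} {1F} _ = refl
  ι-injective {2F} {2F} _ = refl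
  ι-injective {3F} {3F} _ = refl
  ι-injective {0F} {2F} e = ⊥-elim (u≢w (sym (just-injective e)))
  ι-injective {0F} {3F} e = ⊥-elim (v≢w (sym (just-injective e)))
  ι-injective {2F} {0F} e = ⊥-elim (u≢w (just-injective e))
  ι-injective {2F} {3F} e = ⊥-elim (u≢v (just-injective e))
  ι-injective {3F} {0F} e = ⊥-elim (v≢w (just-injective e))
  ι-injective {3F} {2F} e = ⊥-elim (u≢v (sym (just-injective e)))
  ι-injective {0F} {1F} ()
  ι-injective {1F} {0F} ()
  ι-injective {1F} {2F} ()
  ι-injective {1F} {3F} ()
  ι-injective {2F} {1F} ()
  ι-injective {3F} {1F} ()

  ι∈S : ∀ a → InExt S (ι a)
  ι∈S 0F = w∈S
  ι∈S 1F = tt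
  ι∈S 2F = u∈S
  ι∈S 3F = v∈S

  ι-edges : ∀ a b → adj K4⁻ a b ≡ true → extAdj G I (ι a) (ι b) ≡ true
  ι-edges 0F 2F _ = trans (adj-sym G w u) u~w
  ι-edges 0F 3F _ = trans (adj-sym G w v) v~w
  ι-edges 1F 2F _ = u∈I
  ι-edges 1F 3F _ = v∈I
  ι-edges 2F 0F _ = u~w
  ι-edges 2F 1F _ = u∈I
  ι-edges 2F 3F _ = u~v
  ι-edges 3F 0F _ = v~w
  ι-edges 3F 1F _ = v∈I
  ι-edges 3F 2F _ = trans (adj-sym G v u) u~v
  ι-edges 0F 0F ()
  ι-edges 0F 1F ()
  ι-edges 1F 0F ()
  ι-edges 1F 1F ()
  ι-edges 2F 2F ()
  ι-edges 3F 3F ()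

module Triangle (G : Graph) {u v w : Fin (n G)}
  (u~v : adj G u v ≡ true) (v~w : adj G v w ≡ true) (u~w : adj G u w ≡ true) where

  S R : Subset (n G)
  S = ⁅ u ⁆ ∪ ⁅ v ⁆ ∪ ⁅ w ⁆
  R = S ─ ⁅ w ⁆

  u≢v : u ≢ v
  u≢v = adj⇒≢ G u~v

  v≢w : v ≢ w
  v≢w = adj⇒≢ G v~w

  u≢w : u ≢ w
  u≢w = adj⇒≢ G u~w

  u∈S : u ∈ S
  u∈S = x∈p∪q⁺ (inj₁ (x∈⁅x⁆ u))

  v∈S : v ∈ S
  v∈S = x∈p∪q⁺ (inj₂ (x∈p∪q⁺ (inj₁ (x∈⁅x⁆ v))))

  w∈S : w ∈ S
  w∈S = x∈p∪q⁺ (inj₂ (x∈p∪q⁺ (inj₂ (x∈⁅x⁆ w))))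

  u∈R : u ∈ R
  u∈R = x∈p∧x≢y⇒x∈p-y u∈S u≢w

  v∈R : v ∈ R
  v∈R = x∈p∧x≢y⇒x∈p-y v∈S v≢w

  ⁅w⁆⊂S : ⁅ w ⁆ ⊂ S
  ⁅w⁆⊂S =
    (λ x∈⁅w⁆ → subst (_∈ S) (sym (x∈⁅y⁆⇒x≡y w x∈⁅w⁆)) w∈S) , u , u∈S , u≢w ∘ x∈⁅y⁆⇒x≡y w

  R⊆uv : ∀ {y} → y ∈ R → y ≡ u ⊎ y ≡ v
  R⊆uv y∈R with x∈p∪q⁻ ⁅ u ⁆ (⁅ v ⁆ ∪ ⁅ w ⁆) (p─q⊆p S ⁅ w ⁆ y∈R)
  ... | inj₁ y∈⁅u⁆ = inj₁ (x∈⁅y⁆⇒x≡y u y∈⁅u⁆)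
  ... | inj₂ y∈⁅v,w⁆ with x∈p∪q⁻ ⁅ v ⁆ ⁅ w ⁆ y∈⁅v,w⁆
  ...   | inj₁ y∈⁅v⁆ = inj₂ (x∈⁅y⁆⇒x≡y v y∈⁅v⁆)
  ...   | inj₂ y∈⁅w⁆ = contradiction y∈⁅w⁆ (x∈p─q⇒x∉q S ⁅ w ⁆ y∈R)

  OneTwoBound : (Fin (n G) → ℤ) → Set
  OneTwoBound f = (+ 1 ℤ.≤ f u × + 2 ℤ.≤ f v) ⊎ (+ 2 ℤ.≤ f u × + 1 ℤ.≤ f v)

  one-two-colorable : ∀ {f L} → IsAssignment R f L → OneTwoBound f → Colorable G R L
  one-two-colorable {L = L} A (inj₁ (1≤fu , 2≤fv)) =
    pair-colorable G R L u≢v R⊆uv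
      (assignment⇒length≥ A u∈R 1≤fu) (assignment⇒length≥ A v∈R 2≤fv) (proj₁ (A v v∈R))
  one-two-colorable {L = L} A (inj₂ (2≤fu , 1≤fv)) =
    pair-colorable G R L (u≢v ∘ sym) (swap ∘ R⊆uv)
      (assignment⇒length≥ A v∈R 1≤fv) (assignment⇒length≥ A u∈R 2≤fu) (proj₁ (A u u∈R))

  module _ {k : ℕ} (du : deg G u + 1 ≡ k) (dv : deg G v + 1 ≡ k) where

    g : Fin (n G) → ℤ
    g = budget k G R

    2≤gu : + 2 ℤ.≤ g u
    2≤gu = adj⇒2≤budget k G R du u~v v∈R

    2≤gv : + 2 ℤ.≤ g v
    2≤gv = adj⇒2≤budget k G R dv (trans (adj-sym G v u) u~v) u∈R

    fix-bound : ∀ {x} → x ∈ R → OneTwoBound (g ↓ x)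
    fix-bound x∈R with R⊆uv x∈R
    ... | inj₁ refl =
      inj₁ ( ℤₚ.≤-reflexive (sym (↓-self g u))
           , subst (+ 2 ℤ.≤_) (sym (↓-other g u v (u≢v ∘ sym))) 2≤gv)
    ... | inj₂ refl =
      inj₂ ( subst (+ 2 ℤ.≤_) (sym (↓-other g v u u≢v)) 2≤gu
           , ℤₚ.≤-reflexive (sym (↓-self g v)))

    forb-bound : ∀ I → ¬ ContainsExt K4⁻ G S I → OneTwoBound (λ y → g y ℤ.- 𝟙 I y)
    forb-bound I no-K₄⁻ = by-membership (lookup I u) (lookup I v) refl refl
      where
      by-membership : ∀ bu bv → lookup I u ≡ bu → lookup I v ≡ bv →
        OneTwoBound (λ y → g y ℤ.- 𝟙 I y)
      by-membership _ false _ v∉I =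
        inj₁ (-𝟙-≥ I u 2≤gu , subst (+ 2 ℤ.≤_) (sym (-𝟙-outside I v v∉I)) 2≤gv)
      by-membership false true u∉I _ =
        inj₂ (subst (+ 2 ℤ.≤_) (sym (-𝟙-outside I u u∉I)) 2≤gu , -𝟙-≥ I v 2≤gv)
      by-membership true true u∈I v∈I =
        ⊥-elim (no-K₄⁻ (triangle+apex⇒K₄⁻ G u~v v~w u~w u∈S v∈S w∈S u∈I v∈I))

lemma5 : (k : ℕ) → 4 ≤ k → (G : Graph) → (u v w : Fin (n G)) →
    adj G u v ≡ true → adj G v w ≡ true → adj G u w ≡ true →
    deg G u + 1 ≡ k → deg G v + 1 ≡ k →
    BoundaryReducible (λ F → F ≡ K4⁻) k G (⁅ u ⁆ ∪ ⁅ v ⁆ ∪ ⁅ w ⁆) ⁅ w ⁆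
lemma5 k _ G u v w u~v v~w u~w du dv =
    ⁅w⁆⊂S
  , (λ x x∈R L A → one-two-colorable A (fix-bound du dv x∈R))
  , (λ I _ _ forbidding L A → one-two-colorable A (forb-bound du dv I (forbidding K4⁻ refl)))
  where open Triangle G u~v v~w u~w
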